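{- Let $B\geq 2$ and let $a_1,\dots,a_r\geq 0$ be integers. Then $$s_B\left( \sum_{i=1}^{r} a_i \right)=\sum_{i=1}^{r }s_B(a_i)- \widehat{c}_B\left( a_1,a_2,\dots,a_r \right),$$ where $\widehat{c}_B(a_1,\dots,a_r):=\beta-s_B(\beta)+(B-1)c_B(a_1,\dots,a_r)$.
   Context: For an integer $a\geq 0$, $s_B(a)$ is the sum of its base-$B$ digits ($s_B(0)=0$). Write each $a_i=\sum_{j\ge 0}\alpha_{i,j}B^j$ with digits $0\le \alpha_{i,j}<B$, and let $t\ge 0$ be the largest exponent $j$ such that some $\alpha_{i,j}\neq 0$ (take $t=0$ if all $a_i=0$). The carries of the traditional base-$B$ column addition algorithm for $a_1+\dots+a_r$ are $\delta_0=\lfloor(\alpha_{1,0}+\dots+\alpha_{r,0})/B\rfloor$ and $\delta_j=\lfloor(\alpha_{1,j}+\dots+\alpha_{r,j}+\delta_{j-1})/B\rfloor$ for $1\le j\le t$. The carry sum is $c_B(a_1,\dots,a_r)=\sum_{j=0}^{t}\delta_j$ and the terminal carry (the carry left over from the left-most column, which is brought down to form the left-most digits of the sum) is $\beta=\delta_t$. -}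

module Defs where

open import Data.Nat using (ℕ; zero; suc; _+_; _*_; _≟_; NonZero)
open import Data.Nat.DivMod using (_/_; _%_)
open import Data.List using (List; map; upTo)
open import Data.Nat.ListAction using (sum)
open import Data.Bool using (if_then_else_)
open import Relation.Nullary.Decidable using (⌊_⌋)
open import Data.Nat using (_⊔_)

module _ (B : ℕ) .{{_ : NonZero B}} where

  shift : ℕ → ℕ → ℕ
  shift a zero    = a
  shift a (suc j) = shift a j / B

  digit : ℕ → ℕ → ℕ
  digit a j = shift a j % B

  -- s_B(a): sum of the base-B digits of a.  For B ≥ 2 every digit of a at
  -- position j ≥ a is 0 (a < B^a when a ≥ 1), so positions 0..a cover all digits.
  sB : ℕ → ℕ
  sB a = sum (map (digit a) (upTo (suc a)))

  colSum : List ℕ → ℕ → ℕ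
  colSum as j = sum (map (λ a → digit a j) as)

  -- t: the largest j such that some α_{i,j} ≠ 0 (0 if all a_i = 0).
  -- Positions j ≥ a_1 + … + a_r + 1 carry only zero digits, so we search below that bound.
  topCol : List ℕ → ℕ
  topCol as = go (suc (sum as))
    where
    go : ℕ → ℕ
    go zero    = 0
    go (suc j) = if ⌊ colSum as j ≟ 0 ⌋ then go j else j

  carry : List ℕ → ℕ → ℕ
  carry as zero    = colSum as 0 / B
  carry as (suc j) = (colSum as (suc j) + carry as j) / B

  carrySum : List ℕ → ℕ
  carrySum as = sum (map (carry as) (upTo (suc (topCol as))))

  terminalCarry : List ℕ → ℕ
  terminalCarry as = carry as (topCol as)

{-# OPTIONS --safe #-}

-- Writing S = a₁ + … + aᵣ and δ₋₁ = 0, column j of the addition algorithm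
-- says  digit_j(S) + B·δ_j = (α_{1,j} + … + α_{r,j}) + δ_{j-1}.  Summing over
-- the columns j ≤ t telescopes the carries:
--   Σ_{j≤t} digit_j(S) + (B − 1)·c_B + β = s_B(a₁) + … + s_B(a_r),
-- and the digits of S above column t are those of ⌊S / B^{t+1}⌋ = β, which
-- contribute s_B(β).

module Submission where

open import Defs
open import Data.Nat using (ℕ; _≤_; NonZero)
open import Data.List using (List; map)
open import Data.Nat.ListAction using (sum)
open import Relation.Binary.PropositionalEquality using (_≡_)

-- Natural-number arithmetic is opened only inside this block, so that the
-- operators of the statement below refer to the integers.
module _ where
  open import Data.Nat using (zero; suc; pred; _+_; _*_; _∸_; _≟_; z≤n)
  open import Data.Nat.Properties
  open import Data.Nat.DivMod
    using (_/_; _%_; m≡m%n+[m/n]*n; [m+kn]%n≡m%n; +-distrib-/-∣ʳ; m*n/n≡m; m/n<m; 0/n≡0; m*n%n≡0)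
  open import Data.Nat.Divisibility using (n∣m*n)
  open import Data.Nat.Tactic.RingSolver using (solve-∀)
  open import Algebra.Properties.CommutativeSemigroup +-commutativeSemigroup using (interchange; xy∙z≈xz∙y)
  open import Data.List using ([]; _∷_; applyUpTo)
  open import Data.List.Properties using (map-upTo; map-id)
  open import Data.Bool using (if_then_else_)
  open import Data.Sum using (inj₁; inj₂)
  open import Data.Product using (_×_; _,_; proj₁; proj₂)
  open import Relation.Nullary using (yes; no)
  open import Relation.Nullary.Decidable using (⌊_⌋)
  open import Relation.Binary.PropositionalEquality
    using (refl; sym; trans; cong; cong₂; subst; _≗_; module ≡-Reasoning)

  VanishesFrom : (ℕ → ℕ) → ℕ → Set
  VanishesFrom f k = ∀ j → k ≤ j → f j ≡ 0

  sum-applyUpTo-cong : ∀ {f g : ℕ → ℕ} → f ≗ g → ∀ m →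
                       sum (applyUpTo f m) ≡ sum (applyUpTo g m)
  sum-applyUpTo-cong f≗g zero    = refl
  sum-applyUpTo-cong f≗g (suc m) =
    cong₂ _+_ (f≗g 0) (sum-applyUpTo-cong (λ j → f≗g (suc j)) m)

  sum-applyUpTo-+ : ∀ (f g : ℕ → ℕ) m →
    sum (applyUpTo (λ j → f j + g j) m) ≡ sum (applyUpTo f m) + sum (applyUpTo g m)
  sum-applyUpTo-+ f g zero    = refl
  sum-applyUpTo-+ f g (suc m) =
    trans (cong (f 0 + g 0 +_) (sum-applyUpTo-+ (λ j → f (suc j)) (λ j → g (suc j)) m))
          (interchange (f 0) (g 0) _ _)

  sum-applyUpTo-*ˡ : ∀ n (f : ℕ → ℕ) m →
    sum (applyUpTo (λ j → n * f j) m) ≡ n * sum (applyUpTo f m)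
  sum-applyUpTo-*ˡ n f zero    = sym (*-zeroʳ n)
  sum-applyUpTo-*ˡ n f (suc m) =
    trans (cong (n * f 0 +_) (sum-applyUpTo-*ˡ n (λ j → f (suc j)) m))
          (sym (*-distribˡ-+ n (f 0) _))

  sum-applyUpTo-++ : ∀ (f : ℕ → ℕ) k m →
    sum (applyUpTo f (k + m)) ≡ sum (applyUpTo f k) + sum (applyUpTo (λ j → f (k + j)) m)
  sum-applyUpTo-++ f zero    m = refl
  sum-applyUpTo-++ f (suc k) m =
    trans (cong (f 0 +_) (sum-applyUpTo-++ (λ j → f (suc j)) k m))
          (sym (+-assoc (f 0) _ _))

  sum-applyUpTo-∷ʳ : ∀ (f : ℕ → ℕ) m → sum (applyUpTo f (suc m)) ≡ sum (applyUpTo f m) + f m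
  sum-applyUpTo-∷ʳ f zero    = +-identityʳ (f 0)
  sum-applyUpTo-∷ʳ f (suc m) =
    trans (cong (f 0 +_) (sum-applyUpTo-∷ʳ (λ j → f (suc j)) m))
          (sym (+-assoc (f 0) _ _))

  sum-applyUpTo-zero : ∀ {f : ℕ → ℕ} → (∀ j → f j ≡ 0) → ∀ m → sum (applyUpTo f m) ≡ 0
  sum-applyUpTo-zero f≡0 zero    = refl
  sum-applyUpTo-zero f≡0 (suc m) =
    cong₂ _+_ (f≡0 0) (sum-applyUpTo-zero (λ j → f≡0 (suc j)) m)

  sum-applyUpTo-vanishesFrom : ∀ {f k m} → VanishesFrom f k → k ≤ m →
                               sum (applyUpTo f m) ≡ sum (applyUpTo f k)
  sum-applyUpTo-vanishesFrom {f} {k} {m} f≡0 k≤m = begin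
    sum (applyUpTo f m)                  ≡⟨ cong (λ n → sum (applyUpTo f n)) (m+[n∸m]≡n k≤m) ⟨
    sum (applyUpTo f (k + (m ∸ k)))      ≡⟨ sum-applyUpTo-++ f k (m ∸ k) ⟩
    sum (applyUpTo f k) + sum (applyUpTo (λ j → f (k + j)) (m ∸ k))
      ≡⟨ cong (sum (applyUpTo f k) +_)
              (sum-applyUpTo-zero (λ j → f≡0 (k + j) (m≤m+n k j)) (m ∸ k)) ⟩
    sum (applyUpTo f k) + 0              ≡⟨ +-identityʳ _ ⟩
    sum (applyUpTo f k)                  ∎
    where open ≡-Reasoning

  lastNonzeroBelow : (ℕ → ℕ) → ℕ → ℕ
  lastNonzeroBelow f zero    = 0
  lastNonzeroBelow f (suc j) = if ⌊ f j ≟ 0 ⌋ then lastNonzeroBelow f j else j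

  vanishesFrom-lastNonzeroBelow : ∀ f n → VanishesFrom f n →
                                  VanishesFrom f (suc (lastNonzeroBelow f n))
  vanishesFrom-lastNonzeroBelow f zero    f≡0 j _ = f≡0 j z≤n
  vanishesFrom-lastNonzeroBelow f (suc n) f≡0 with f n ≟ 0
  ... | no  _    = f≡0
  ... | yes fn≡0 = vanishesFrom-lastNonzeroBelow f n f≡0′
    where
    f≡0′ : VanishesFrom f n
    f≡0′ j n≤j with m≤n⇒m<n∨m≡n n≤j
    ... | inj₁ n<j  = f≡0 j n<j
    ... | inj₂ refl = fn≡0

  module _ (B : ℕ) .{{_ : NonZero B}} where

    shift-shift : ∀ a k j → shift B (shift B a k) j ≡ shift B a (k + j)
    shift-shift a k zero    = cong (shift B a) (sym (+-identityʳ k))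
    shift-shift a k (suc j) =
      trans (cong (_/ B) (shift-shift a k j)) (cong (shift B a) (sym (+-suc k j)))

    digit-shift : ∀ a k j → digit B (shift B a k) j ≡ digit B a (k + j)
    digit-shift a k j = cong (_% B) (shift-shift a k j)

    shift≡digit+B*shift : ∀ a j → shift B a j ≡ digit B a j + B * shift B a (suc j)
    shift≡digit+B*shift a j =
      trans (m≡m%n+[m/n]*n (shift B a j) B) (cong (digit B a j +_) (*-comm (shift B a j / B) B))

    [m+n*B]/B≡m/B+n : ∀ m n → (m + n * B) / B ≡ m / B + n
    [m+n*B]/B≡m/B+n m n = trans (+-distrib-/-∣ʳ m (n∣m*n n)) (cong (m / B +_) (m*n/n≡m n B))

    shiftSum : List ℕ → ℕ → ℕ
    shiftSum as j = sum (map (λ a → shift B a j) as)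

    shiftSum≡colSum+B*shiftSum : ∀ as j → shiftSum as j ≡ colSum B as j + B * shiftSum as (suc j)
    shiftSum≡colSum+B*shiftSum []       j = sym (*-zeroʳ B)
    shiftSum≡colSum+B*shiftSum (a ∷ as) j = begin
      shift B a j + shiftSum as j
        ≡⟨ cong₂ _+_ (shift≡digit+B*shift a j) (shiftSum≡colSum+B*shiftSum as j) ⟩
      (digit B a j + B * shift B a (suc j)) + (colSum B as j + B * shiftSum as (suc j))
        ≡⟨ interchange (digit B a j) _ (colSum B as j) _ ⟩
      (digit B a j + colSum B as j) + (B * shift B a (suc j) + B * shiftSum as (suc j))
        ≡⟨ cong (digit B a j + colSum B as j +_) (*-distribˡ-+ B _ _) ⟨
      (digit B a j + colSum B as j) + B * (shift B a (suc j) + shiftSum as (suc j)) ∎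
      where open ≡-Reasoning

    module _ (as : List ℕ) where

      carryIn : ℕ → ℕ
      carryIn zero    = 0
      carryIn (suc j) = carry B as j

      carry≡ : ∀ j → carry B as j ≡ (colSum B as j + carryIn j) / B
      carry≡ zero    = cong (_/ B) (sym (+-identityʳ _))
      carry≡ (suc j) = refl

      mutual
        shift[sum]≡shiftSum+carryIn : ∀ j → shift B (sum as) j ≡ shiftSum as j + carryIn j
        shift[sum]≡shiftSum+carryIn zero    = sym (trans (+-identityʳ _) (cong sum (map-id as)))
        shift[sum]≡shiftSum+carryIn (suc j) = begin
          shift B (sum as) j / B                 ≡⟨ cong (_/ B) (shift[sum]≡column+shiftSum*B j) ⟩
          (X + shiftSum as (suc j) * B) / B      ≡⟨ [m+n*B]/B≡m/B+n X _ ⟩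
          X / B + shiftSum as (suc j)            ≡⟨ cong (_+ shiftSum as (suc j)) (carry≡ j) ⟨
          carry B as j + shiftSum as (suc j)     ≡⟨ +-comm (carry B as j) _ ⟩
          shiftSum as (suc j) + carryIn (suc j)  ∎
          where
          X = colSum B as j + carryIn j
          open ≡-Reasoning

        shift[sum]≡column+shiftSum*B : ∀ j →
          shift B (sum as) j ≡ (colSum B as j + carryIn j) + shiftSum as (suc j) * B
        shift[sum]≡column+shiftSum*B j = begin
          shift B (sum as) j
            ≡⟨ shift[sum]≡shiftSum+carryIn j ⟩
          shiftSum as j + carryIn j
            ≡⟨ cong (_+ carryIn j) (shiftSum≡colSum+B*shiftSum as j) ⟩
          colSum B as j + B * shiftSum as (suc j) + carryIn j
            ≡⟨ xy∙z≈xz∙y (colSum B as j) _ (carryIn j) ⟩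
          colSum B as j + carryIn j + B * shiftSum as (suc j)
            ≡⟨ cong (colSum B as j + carryIn j +_) (*-comm B _) ⟩
          colSum B as j + carryIn j + shiftSum as (suc j) * B ∎
          where open ≡-Reasoning

      column-identity : ∀ j → digit B (sum as) j + B * carry B as j ≡ colSum B as j + carryIn j
      column-identity j = begin
        digit B (sum as) j + B * carry B as j
          ≡⟨ cong₂ (λ d c → d + B * c)
                   (trans (cong (_% B) (shift[sum]≡column+shiftSum*B j))
                          ([m+kn]%n≡m%n X (shiftSum as (suc j)) B))
                   (carry≡ j) ⟩
        X % B + B * (X / B)   ≡⟨ cong (X % B +_) (*-comm B (X / B)) ⟩
        X % B + X / B * B     ≡⟨ m≡m%n+[m/n]*n X B ⟨
        X                     ∎
        where
        X = colSum B as j + carryIn j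
        open ≡-Reasoning

      digits+B*carries≡columns+carriesIn : ∀ m →
        sum (applyUpTo (digit B (sum as)) m) + B * sum (applyUpTo (carry B as) m)
          ≡ sum (applyUpTo (colSum B as) m) + sum (applyUpTo carryIn m)
      digits+B*carries≡columns+carriesIn m = begin
        sum (applyUpTo (digit B (sum as)) m) + B * sum (applyUpTo (carry B as) m)
          ≡⟨ cong (sum (applyUpTo (digit B (sum as)) m) +_) (sum-applyUpTo-*ˡ B (carry B as) m) ⟨
        sum (applyUpTo (digit B (sum as)) m) + sum (applyUpTo (λ j → B * carry B as j) m)
          ≡⟨ sum-applyUpTo-+ (digit B (sum as)) (λ j → B * carry B as j) m ⟨
        sum (applyUpTo (λ j → digit B (sum as) j + B * carry B as j) m)
          ≡⟨ sum-applyUpTo-cong column-identity m ⟩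
        sum (applyUpTo (λ j → colSum B as j + carryIn j) m)
          ≡⟨ sum-applyUpTo-+ (colSum B as) carryIn m ⟩
        sum (applyUpTo (colSum B as) m) + sum (applyUpTo carryIn m) ∎
        where open ≡-Reasoning

      -- The local search function of topCol is not exported by Defs; go recovers
      -- it as the solution of a metavariable, fixed by unfolding topCol once.
      private
        mutual
          go : ℕ → ℕ
          go = _

          topCol-unfold : topCol B as ≡ (if ⌊ colSum B as (sum as) ≟ 0 ⌋ then go (sum as) else sum as)
          topCol-unfold with sum as
          ... | _ = refl

        go≡lastNonzeroBelow : ∀ n → go n ≡ lastNonzeroBelow (colSum B as) n
        go≡lastNonzeroBelow zero    = refl
        go≡lastNonzeroBelow (suc n) =
          cong (λ r → if ⌊ colSum B as n ≟ 0 ⌋ then r else n) (go≡lastNonzeroBelow n)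

      topCol≡lastNonzeroBelow : topCol B as ≡ lastNonzeroBelow (colSum B as) (suc (sum as))
      topCol≡lastNonzeroBelow =
        trans topCol-unfold
              (cong (λ r → if ⌊ colSum B as (sum as) ≟ 0 ⌋ then r else sum as)
                    (go≡lastNonzeroBelow (sum as)))

    module _ (2≤B : 2 ≤ B) where

      /B≤pred : ∀ m → m / B ≤ pred m
      /B≤pred zero    = ≤-reflexive (0/n≡0 B)
      /B≤pred (suc m) = ≤-pred (m/n<m (suc m) B 2≤B)

      shift≤∸ : ∀ a j → shift B a j ≤ a ∸ j
      shift≤∸ a zero    = ≤-refl
      shift≤∸ a (suc j) = begin
        shift B a j / B     ≤⟨ /B≤pred (shift B a j) ⟩
        pred (shift B a j)  ≤⟨ pred-mono-≤ (shift≤∸ a j) ⟩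
        pred (a ∸ j)        ≡⟨ pred[m∸n]≡m∸[1+n] a j ⟩
        a ∸ suc j           ∎
        where open ≤-Reasoning

      shift≤ : ∀ a j → shift B a j ≤ a
      shift≤ a j = ≤-trans (shift≤∸ a j) (m∸n≤m a j)

      shift-vanishes : ∀ {a j} → a ≤ j → shift B a j ≡ 0
      shift-vanishes {a} {j} a≤j =
        n≤0⇒n≡0 (≤-trans (shift≤∸ a j) (≤-reflexive (m≤n⇒m∸n≡0 a≤j)))

      digit-vanishes : ∀ a → VanishesFrom (digit B a) a
      digit-vanishes a j a≤j = trans (cong (_% B) (shift-vanishes a≤j)) (m*n%n≡0 0 B)

      digits-vanish⇒shift≡0 : ∀ {a k} → VanishesFrom (digit B a) k → shift B a k ≡ 0
      digits-vanish⇒shift≡0 {a} {k} = descend a k (m≤m+n a k)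
        where
        descend : ∀ d k → a ≤ d + k → VanishesFrom (digit B a) k → shift B a k ≡ 0
        descend zero    k a≤k     _     = shift-vanishes a≤k
        descend (suc d) k a≤d+1+k dig≡0 = begin
          shift B a k                           ≡⟨ shift≡digit+B*shift a k ⟩
          digit B a k + B * shift B a (suc k)
            ≡⟨ cong₂ (λ x y → x + B * y) (dig≡0 k ≤-refl)
                     (descend d (suc k) (≤-trans a≤d+1+k (≤-reflexive (sym (+-suc d k))))
                         (λ j k<j → dig≡0 j (≤-trans (n≤1+n k) k<j))) ⟩
          0 + B * 0                             ≡⟨ *-zeroʳ B ⟩
          0                                     ∎
          where open ≡-Reasoning

      sum-digits≡sB : ∀ {a m} → a ≤ m → sum (applyUpTo (digit B a) m) ≡ sB B a
      sum-digits≡sB {a} {m} a≤m = begin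
        sum (applyUpTo (digit B a) m)       ≡⟨ sum-applyUpTo-vanishesFrom (digit-vanishes a) a≤m ⟩
        sum (applyUpTo (digit B a) a)       ≡⟨ sum-applyUpTo-vanishesFrom (digit-vanishes a) (n≤1+n a) ⟨
        sum (applyUpTo (digit B a) (suc a)) ≡⟨ cong sum (map-upTo (digit B a) (suc a)) ⟨
        sB B a                              ∎
        where open ≡-Reasoning

      sB≡sum-digits : ∀ {a k} → VanishesFrom (digit B a) k → sB B a ≡ sum (applyUpTo (digit B a) k)
      sB≡sum-digits {a} {k} dig≡0 =
        trans (sym (sum-digits≡sB (m≤n+m a k))) (sum-applyUpTo-vanishesFrom dig≡0 (m≤m+n k a))

      sB-split : ∀ a k → sB B a ≡ sum (applyUpTo (digit B a) k) + sB B (shift B a k)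
      sB-split a k = begin
        sB B a                                       ≡⟨ sum-digits≡sB (m≤n+m a k) ⟨
        sum (applyUpTo (digit B a) (k + a))          ≡⟨ sum-applyUpTo-++ (digit B a) k a ⟩
        sum (applyUpTo (digit B a) k) + sum (applyUpTo (λ j → digit B a (k + j)) a)
          ≡⟨ cong (sum (applyUpTo (digit B a) k) +_)
                  (sum-applyUpTo-cong (λ j → sym (digit-shift a k j)) a) ⟩
        sum (applyUpTo (digit B a) k) + sum (applyUpTo (digit B (shift B a k)) a)
          ≡⟨ cong (sum (applyUpTo (digit B a) k) +_) (sum-digits≡sB (shift≤ a k)) ⟩
        sum (applyUpTo (digit B a) k) + sB B (shift B a k) ∎
        where open ≡-Reasoning

      colSum-vanishes : ∀ as → VanishesFrom (colSum B as) (sum as)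
      colSum-vanishes []       j _       = refl
      colSum-vanishes (a ∷ as) j a+s≤j =
        cong₂ _+_ (digit-vanishes a j (≤-trans (m≤m+n a (sum as)) a+s≤j))
                  (colSum-vanishes as j (≤-trans (m≤n+m (sum as) a) a+s≤j))

      colSum-vanishes-above-topCol : ∀ as → VanishesFrom (colSum B as) (suc (topCol B as))
      colSum-vanishes-above-topCol as =
        subst (λ t → VanishesFrom (colSum B as) (suc t)) (sym (topCol≡lastNonzeroBelow as))
              (vanishesFrom-lastNonzeroBelow (colSum B as) (suc (sum as))
                 (λ j s<j → colSum-vanishes as j (≤-trans (n≤1+n (sum as)) s<j)))

      colSum-∷-vanishesFrom : ∀ a as {k} → VanishesFrom (colSum B (a ∷ as)) k →
                              VanishesFrom (digit B a) k × VanishesFrom (colSum B as) k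
      colSum-∷-vanishesFrom a as col≡0 =
        (λ j k≤j → m+n≡0⇒m≡0 (digit B a j) (col≡0 j k≤j)) ,
        (λ j k≤j → m+n≡0⇒n≡0 (digit B a j) (col≡0 j k≤j))

      sum-columns≡sum-sB : ∀ as {k} → VanishesFrom (colSum B as) k →
                           sum (applyUpTo (colSum B as) k) ≡ sum (map (sB B) as)
      sum-columns≡sum-sB []       {k} _     = sum-applyUpTo-zero (λ _ → refl) k
      sum-columns≡sum-sB (a ∷ as) {k} col≡0 =
        trans (sum-applyUpTo-+ (digit B a) (colSum B as) k)
              (cong₂ _+_ (sym (sB≡sum-digits dig≡0)) (sum-columns≡sum-sB as col≡0′))
        where
        dig≡0   = proj₁ (colSum-∷-vanishesFrom a as col≡0)
        col≡0′  = proj₂ (colSum-∷-vanishesFrom a as col≡0)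

      shiftSum-vanishes : ∀ as {k} → VanishesFrom (colSum B as) k → shiftSum as k ≡ 0
      shiftSum-vanishes []       _     = refl
      shiftSum-vanishes (a ∷ as) col≡0 =
        cong₂ _+_ (digits-vanish⇒shift≡0 (proj₁ (colSum-∷-vanishesFrom a as col≡0)))
                  (shiftSum-vanishes as (proj₂ (colSum-∷-vanishesFrom a as col≡0)))

      sB-sum : ∀ as →
        sB B (sum as) + terminalCarry B as + B * carrySum B as
          ≡ sum (map (sB B) as) + sB B (terminalCarry B as) + carrySum B as
      sB-sum as = begin
        sB B S + β + B * c                   ≡⟨ cong (λ x → x + β + B * c) sB[S]≡D+sB[β] ⟩
        D + sB B β + β + B * c               ≡⟨ regroupˡ D (sB B β) β (B * c) ⟩
        (D + B * c) + sB B β + β             ≡⟨ cong (λ x → x + sB B β + β) D+B*c≡Y+c′ ⟩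
        (Y + c′) + sB B β + β                ≡⟨ regroupʳ Y c′ (sB B β) β ⟩
        Y + sB B β + (c′ + β)                ≡⟨ cong (Y + sB B β +_) c≡c′+β ⟨
        Y + sB B β + c                       ∎
        where
        open ≡-Reasoning
        S = sum as
        t = topCol B as
        β = terminalCarry B as
        c = carrySum B as
        c′ = sum (applyUpTo (carry B as) t)
        D = sum (applyUpTo (digit B S) (suc t))
        Y = sum (map (sB B) as)
        col≡0 = colSum-vanishes-above-topCol as

        c≡c′+β : c ≡ c′ + β
        c≡c′+β = trans (cong sum (map-upTo (carry B as) (suc t))) (sum-applyUpTo-∷ʳ (carry B as) t)

        shift[S]≡β : shift B S (suc t) ≡ β
        shift[S]≡β = trans (shift[sum]≡shiftSum+carryIn as (suc t))
                           (cong (_+ β) (shiftSum-vanishes as col≡0))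

        sB[S]≡D+sB[β] : sB B S ≡ D + sB B β
        sB[S]≡D+sB[β] = trans (sB-split S (suc t)) (cong (λ x → D + sB B x) shift[S]≡β)

        D+B*c≡Y+c′ : D + B * c ≡ Y + c′
        D+B*c≡Y+c′ = begin
          D + B * c
            ≡⟨ cong (λ x → D + B * sum x) (map-upTo (carry B as) (suc t)) ⟩
          D + B * sum (applyUpTo (carry B as) (suc t))
            ≡⟨ digits+B*carries≡columns+carriesIn as (suc t) ⟩
          sum (applyUpTo (colSum B as) (suc t)) + c′
            ≡⟨ cong (_+ c′) (sum-columns≡sum-sB as col≡0) ⟩
          Y + c′ ∎

        regroupˡ : ∀ d s b x → d + s + b + x ≡ d + x + s + b
        regroupˡ = solve-∀

        regroupʳ : ∀ y c s b → y + c + s + b ≡ y + s + (c + b)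
        regroupʳ = solve-∀

open import Data.Integer using (ℤ; +_; _-_; _+_; _*_)
open import Data.Integer.Properties using (pos-+; pos-*)
open import Data.Integer.Tactic.RingSolver using (solve-∀)
open import Relation.Binary.PropositionalEquality using (cong; cong₂; module ≡-Reasoning)
import Data.Nat as ℕ

ℕ-identity⇒ℤ : ∀ {x β B c y s} → x ℕ.+ β ℕ.+ B ℕ.* c ≡ y ℕ.+ s ℕ.+ c →
               + x ≡ + y - ((+ β - + s) + (+ B - + 1) * + c)
ℕ-identity⇒ℤ {x} {β} {B} {c} {y} {s} eq = begin
  + x                                            ≡⟨ isolate (+ x) (+ β) (+ B) (+ c) ⟩
  (+ x + + β + + B * + c) - (+ β + + B * + c)    ≡⟨ cong (_- (+ β + + B * + c)) eqℤ ⟩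
  (+ y + + s + + c) - (+ β + + B * + c)          ≡⟨ regroup (+ y) (+ s) (+ β) (+ B) (+ c) ⟩
  + y - ((+ β - + s) + (+ B - + 1) * + c)        ∎
  where
  open ≡-Reasoning

  eqℤ : + x + + β + + B * + c ≡ + y + + s + + c
  eqℤ = begin
    + x + + β + + B * + c          ≡⟨ cong₂ _+_ (pos-+ x β) (pos-* B c) ⟨
    + (x ℕ.+ β) + + (B ℕ.* c)      ≡⟨ pos-+ (x ℕ.+ β) (B ℕ.* c) ⟨
    + (x ℕ.+ β ℕ.+ B ℕ.* c)        ≡⟨ cong +_ eq ⟩
    + (y ℕ.+ s ℕ.+ c)              ≡⟨ pos-+ (y ℕ.+ s) c ⟩
    + (y ℕ.+ s) + + c              ≡⟨ cong (_+ + c) (pos-+ y s) ⟩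
    + y + + s + + c                ∎

  isolate : ∀ x b k c → x ≡ (x + b + k * c) - (b + k * c)
  isolate = solve-∀

  regroup : ∀ y s b k c → (y + s + c) - (b + k * c) ≡ y - ((b - s) + (k - + 1) * c)
  regroup = solve-∀

theorem1p3 : (B : ℕ) → .{{_ : NonZero B}} → 2 ≤ B → (as : List ℕ) →
    + sB B (sum as)
      ≡ + sum (map (sB B) as)
        - ((+ terminalCarry B as - + sB B (terminalCarry B as))
           + (+ B - + 1) * + carrySum B as)
theorem1p3 B 2≤B as =
  ℕ-identity⇒ℤ {B = B} {s = sB B (terminalCarry B as)} (sB-sum B 2≤B as)
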